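{- Let $G$ be any graph. If $\mathbf{cp}(G)\le 3$, then $\mathbf{vsrc}(\hat G)\le 3$.
   Context: All graphs are finite, simple and undirected. $\mathbf{cp}(G)$ is the smallest number of subsets of $V(G)$, each inducing a clique, whose union is $V(G)$. $\hat G$ is the graph obtained from $G$ by adding a new vertex adjacent to all vertices of $G$. A very strong rainbow coloring of a graph $H$ is a coloring of $E(H)$ such that for every pair of vertices and every shortest path between them, all edges of that path receive pairwise different colors; $\mathbf{vsrc}(H)$ is the minimum number of colors in such a coloring. -}

module Defs where

open import Data.Nat using (ℕ; zero; suc; _≤_)
open import Data.Fin using (Fin; zero; suc; inject₁)
open import Data.Bool using (Bool; true; false)
open import Data.Product using (Σ; ∃; _×_; _,_)
open import Relation.Binary.PropositionalEquality using (_≡_; _≢_)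

record Graph : Set where
  field
    n      : ℕ
    adj    : Fin n → Fin n → Bool
    sym    : ∀ u v → adj u v ≡ adj v u
    irrefl : ∀ u → adj u u ≡ false
open Graph public

Adj : (G : Graph) → Fin (n G) → Fin (n G) → Set
Adj G u v = adj G u v ≡ true

IsClique : (G : Graph) → (Fin (n G) → Bool) → Set
IsClique G S = ∀ u v → S u ≡ true → S v ≡ true → u ≢ v → Adj G u v

CliqueCover : (G : Graph) → ℕ → Set
CliqueCover G k =
  Σ (Fin k → Fin (n G) → Bool) λ C →
    (∀ i → IsClique G (C i)) × (∀ v → ∃ λ i → C i v ≡ true)

cp≤ : Graph → ℕ → Set
cp≤ G k = ∃ λ j → j ≤ k × CliqueCover G j

hatAdj : (G : Graph) → Fin (suc (n G)) → Fin (suc (n G)) → Bool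
hatAdj G zero    zero    = false
hatAdj G zero    (suc _) = true
hatAdj G (suc _) zero    = true
hatAdj G (suc u) (suc v) = adj G u v

hatSym : (G : Graph) → ∀ u v → hatAdj G u v ≡ hatAdj G v u
hatSym G zero    zero    = _≡_.refl
hatSym G zero    (suc _) = _≡_.refl
hatSym G (suc _) zero    = _≡_.refl
hatSym G (suc u) (suc v) = sym G u v

hatIrrefl : (G : Graph) → ∀ u → hatAdj G u u ≡ false
hatIrrefl G zero    = _≡_.refl
hatIrrefl G (suc u) = irrefl G u

hat : Graph → Graph
hat G = record { n = suc (n G) ; adj = hatAdj G ; sym = hatSym G ; irrefl = hatIrrefl G }

record Walk (H : Graph) (u v : Fin (n H)) (l : ℕ) : Set where
  field
    vtx   : Fin (suc l) → Fin (n H)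
    start : vtx zero ≡ u
    end   : vtx (Data.Fin.fromℕ l) ≡ v
    step  : ∀ (i : Fin l) → Adj H (vtx (inject₁ i)) (vtx (suc i))
open Walk public

IsShortest : (H : Graph) (u v : Fin (n H)) (l : ℕ) → Walk H u v l → Set
IsShortest H u v l _ = ∀ l' → Data.Nat._<_ l' l → Walk H u v l' → Data.Empty.⊥
  where import Data.Empty

-- An edge coloring with k colors: a color for each ordered pair, symmetric,
-- so it is a function on unordered edges (values on non-edges are irrelevant).
EdgeColoring : Graph → ℕ → Set
EdgeColoring H k =
  Σ (Fin (n H) → Fin (n H) → Fin k) λ c → ∀ u v → Adj H u v → c u v ≡ c v u

IsVeryStrongRainbow : (H : Graph) (k : ℕ) → EdgeColoring H k → Set
IsVeryStrongRainbow H k (c , _) =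
  ∀ u v l (p : Walk H u v l) → IsShortest H u v l p →
    ∀ (i j : Fin l) → i ≢ j →
      c (vtx p (inject₁ i)) (vtx p (suc i)) ≢ c (vtx p (inject₁ j)) (vtx p (suc j))

vsrc≤ : Graph → ℕ → Set
vsrc≤ H k = ∃ λ j → j ≤ k × Σ (EdgeColoring H j) (IsVeryStrongRainbow H j)

-- Label each vertex of G by a clique containing it. In Ĝ the hub joins every vertex, so Ĝ has
-- diameter at most 2 and only induced paths x y z of length 2 matter; their ends x and z are old
-- vertices in different cliques. Colour the edge from the hub to v by the label of v, and an old
-- edge uv by the label combination ℓ u ⋆ ℓ v of the Steiner quasigroup of order 3. If the middle
-- vertex is the hub the two colours are the distinct labels of x and z; otherwise they are
-- ℓ x ⋆ ℓ y and ℓ y ⋆ ℓ z, which differ because ⋆ is commutative and cancellative.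
module Submission where

open import Defs
open import Data.Nat using (ℕ; zero; suc; _≤_; _<_; z≤n; s≤s)
open import Data.Nat.Properties using (≤-refl; ≤-trans; ≮⇒≥)
open import Data.Fin using (Fin; zero; suc; fromℕ; inject₁; inject≤)
open import Data.Fin.Properties using (inject≤-injective)
open import Data.Bool using (true)
open import Data.Product using (Σ; ∃; _×_; _,_; proj₁; proj₂)
open import Data.Empty using (⊥-elim)
open import Function using (_∘_)
open import Relation.Nullary using (¬_)
open import Relation.Binary.PropositionalEquality
  using (_≡_; _≢_; refl; trans; cong; subst; subst₂; ≢-sym; module ≡-Reasoning)
  renaming (sym to ≡-sym)

-- x ⋆ y is the third element of Fin 3 when x ≢ y, and x itself when x ≡ y.
_⋆_ : Fin 3 → Fin 3 → Fin 3
zero           ⋆ zero           = zero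
zero           ⋆ suc zero       = suc (suc zero)
zero           ⋆ suc (suc zero) = suc zero
suc zero       ⋆ zero           = suc (suc zero)
suc zero       ⋆ suc zero       = suc zero
suc zero       ⋆ suc (suc zero) = zero
suc (suc zero) ⋆ zero           = suc zero
suc (suc zero) ⋆ suc zero       = zero
suc (suc zero) ⋆ suc (suc zero) = suc (suc zero)

⋆-comm : ∀ x y → x ⋆ y ≡ y ⋆ x
⋆-comm zero             zero             = refl
⋆-comm zero             (suc zero)       = refl
⋆-comm zero             (suc (suc zero)) = refl
⋆-comm (suc zero)       zero             = refl
⋆-comm (suc zero)       (suc zero)       = refl
⋆-comm (suc zero)       (suc (suc zero)) = refl
⋆-comm (suc (suc zero)) zero             = refl
⋆-comm (suc (suc zero)) (suc zero)       = refl
⋆-comm (suc (suc zero)) (suc (suc zero)) = refl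

⋆-inverseʳ : ∀ x y → (x ⋆ y) ⋆ y ≡ x
⋆-inverseʳ zero             zero             = refl
⋆-inverseʳ zero             (suc zero)       = refl
⋆-inverseʳ zero             (suc (suc zero)) = refl
⋆-inverseʳ (suc zero)       zero             = refl
⋆-inverseʳ (suc zero)       (suc zero)       = refl
⋆-inverseʳ (suc zero)       (suc (suc zero)) = refl
⋆-inverseʳ (suc (suc zero)) zero             = refl
⋆-inverseʳ (suc (suc zero)) (suc zero)       = refl
⋆-inverseʳ (suc (suc zero)) (suc (suc zero)) = refl

⋆-cancel : ∀ x y z → x ⋆ y ≡ y ⋆ z → x ≡ z
⋆-cancel x y z eq = begin
  x             ≡⟨ ≡-sym (⋆-inverseʳ x y) ⟩
  (x ⋆ y) ⋆ y   ≡⟨ cong (_⋆ y) (trans eq (⋆-comm y z)) ⟩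
  (z ⋆ y) ⋆ y   ≡⟨ ⋆-inverseʳ z y ⟩
  z             ∎
  where open ≡-Reasoning

CliqueLabelling : Graph → ℕ → Set
CliqueLabelling G k =
  Σ (Fin (n G) → Fin k) λ ℓ → ∀ a b → ℓ a ≡ ℓ b → a ≢ b → Adj G a b

cp≤⇒cliqueLabelling : ∀ {G k} → cp≤ G k → CliqueLabelling G k
cp≤⇒cliqueLabelling {G} {k} (j , j≤k , C , isClique , covered) = label , sameLabel⇒adj
  where
  clique : Fin (n G) → Fin j
  clique v = proj₁ (covered v)

  label : Fin (n G) → Fin k
  label v = inject≤ (clique v) j≤k

  sameLabel⇒adj : ∀ a b → label a ≡ label b → a ≢ b → Adj G a b
  sameLabel⇒adj a b eq = isClique (clique a) a b (proj₂ (covered a))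
    (subst (λ i → C i b ≡ true)
           (≡-sym (inject≤-injective j≤k j≤k (clique a) (clique b) eq))
           (proj₂ (covered b)))

walk₀ : ∀ {H} {u v : Fin (n H)} → u ≡ v → Walk H u v 0
walk₀ {u = u} u≡v = record { vtx = λ _ → u ; start = refl ; end = u≡v ; step = λ () }

walk₁ : ∀ {H} {u v : Fin (n H)} → Adj H u v → Walk H u v 1
walk₁ {H} {u} {v} uv = record { vtx = vertex ; start = refl ; end = refl ; step = λ { zero → uv } }
  where
  vertex : Fin 2 → Fin (n H)
  vertex zero    = u
  vertex (suc _) = v

walk₂ : ∀ {H} {u w v : Fin (n H)} → Adj H u w → Adj H w v → Walk H u v 2
walk₂ {H} {u} {w} {v} uw wv =
  record { vtx = vertex ; start = refl ; end = refl ; step = λ { zero → uw ; (suc zero) → wv } }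
  where
  vertex : Fin 3 → Fin (n H)
  vertex zero          = u
  vertex (suc zero)    = w
  vertex (suc (suc _)) = v

Diameter≤ : Graph → ℕ → Set
Diameter≤ H d = ∀ u v → ∃ λ l → l ≤ d × Walk H u v l

hat-diameter≤2 : ∀ G → Diameter≤ (hat G) 2
hat-diameter≤2 G zero    zero    = 0 , z≤n , walk₀ refl
hat-diameter≤2 G zero    (suc _) = 1 , s≤s z≤n , walk₁ refl
hat-diameter≤2 G (suc _) zero    = 1 , s≤s z≤n , walk₁ refl
hat-diameter≤2 G (suc _) (suc _) = 2 , ≤-refl , walk₂ {hat G} {w = zero} refl refl

module _ {H : Graph} {u v : Fin (n H)} {l : ℕ}
         (p : Walk H u v l) (shortest : IsShortest H u v l p) where

  shortest-length≤ : ∀ {d} → Diameter≤ H d → l ≤ d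
  shortest-length≤ diam with diam u v
  ... | l′ , l′≤d , q = ≤-trans (≮⇒≥ (λ l′<l → shortest l′ l′<l q)) l′≤d

  shortest⇒ends-distinct : 0 < l → vtx p zero ≢ vtx p (fromℕ l)
  shortest⇒ends-distinct 0<l eq =
    shortest 0 0<l (walk₀ (trans (≡-sym (start p)) (trans eq (end p))))

  shortest⇒ends-nonadjacent : 1 < l → ¬ Adj H (vtx p zero) (vtx p (fromℕ l))
  shortest⇒ends-nonadjacent 1<l adj =
    shortest 1 1<l (walk₁ (subst₂ (Adj H) (start p) (end p) adj))

diameter≤2⇒veryStrongRainbow :
  ∀ {H k} → Diameter≤ H 2 → (χ : EdgeColoring H k) →
  (∀ x y z → x ≢ z → ¬ Adj H x z → proj₁ χ x y ≢ proj₁ χ y z) →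
  IsVeryStrongRainbow H k χ
diameter≤2⇒veryStrongRainbow diam χ inducedP₃ u v zero p shortest ()
diameter≤2⇒veryStrongRainbow diam χ inducedP₃ u v (suc zero) p shortest zero zero 0≢0 =
  ⊥-elim (0≢0 refl)
diameter≤2⇒veryStrongRainbow diam χ inducedP₃ u v (suc (suc zero)) p shortest = distinct
  where
  differ : proj₁ χ (vtx p zero) (vtx p (suc zero))
         ≢ proj₁ χ (vtx p (suc zero)) (vtx p (suc (suc zero)))
  differ = inducedP₃ _ _ _ (shortest⇒ends-distinct p shortest (s≤s z≤n))
                           (shortest⇒ends-nonadjacent p shortest (s≤s (s≤s z≤n)))

  distinct : ∀ i j → i ≢ j →
    proj₁ χ (vtx p (inject₁ i)) (vtx p (suc i)) ≢ proj₁ χ (vtx p (inject₁ j)) (vtx p (suc j))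
  distinct zero       zero       i≢j = ⊥-elim (i≢j refl)
  distinct zero       (suc zero) _   = differ
  distinct (suc zero) zero       _   = ≢-sym differ
  distinct (suc zero) (suc zero) i≢j = ⊥-elim (i≢j refl)
diameter≤2⇒veryStrongRainbow diam χ inducedP₃ u v (suc (suc (suc _))) p shortest
  with shortest-length≤ p shortest diam
... | s≤s (s≤s ())

module HatColouring (G : Graph) (ℓ : Fin (n G) → Fin 3)
                    (sameLabel⇒adj : ∀ a b → ℓ a ≡ ℓ b → a ≢ b → Adj G a b) where

  -- The value at (zero , zero) is irrelevant: the hub is not adjacent to itself.
  colour : Fin (suc (n G)) → Fin (suc (n G)) → Fin 3
  colour zero    zero    = zero
  colour zero    (suc b) = ℓ b
  colour (suc a) zero    = ℓ a
  colour (suc a) (suc b) = ℓ a ⋆ ℓ b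

  colour-sym : ∀ x y → colour x y ≡ colour y x
  colour-sym zero    zero    = refl
  colour-sym zero    (suc _) = refl
  colour-sym (suc _) zero    = refl
  colour-sym (suc a) (suc b) = ⋆-comm (ℓ a) (ℓ b)

  colouring : EdgeColoring (hat G) 3
  colouring = colour , λ x y _ → colour-sym x y

  labels-differ : ∀ {a b} → suc a ≢ suc b → ¬ Adj (hat G) (suc a) (suc b) → ℓ a ≢ ℓ b
  labels-differ {a} {b} a≢b ¬adj eq = ¬adj (sameLabel⇒adj a b eq (a≢b ∘ cong suc))

  colour-inducedP₃ : ∀ x y z → x ≢ z → ¬ Adj (hat G) x z → colour x y ≢ colour y z
  colour-inducedP₃ zero    _       zero    x≢z _    = ⊥-elim (x≢z refl)
  colour-inducedP₃ zero    _       (suc _) _   ¬adj = ⊥-elim (¬adj refl)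
  colour-inducedP₃ (suc _) _       zero    _   ¬adj = ⊥-elim (¬adj refl)
  colour-inducedP₃ (suc a) zero    (suc b) a≢b ¬adj = labels-differ a≢b ¬adj
  colour-inducedP₃ (suc a) (suc w) (suc b) a≢b ¬adj =
    labels-differ a≢b ¬adj ∘ ⋆-cancel (ℓ a) (ℓ w) (ℓ b)

lemma5 : (G : Graph) → cp≤ G 3 → vsrc≤ (hat G) 3
lemma5 G cp with cp≤⇒cliqueLabelling {G} cp
... | ℓ , sameLabel⇒adj =
  3 , ≤-refl , colouring ,
  diameter≤2⇒veryStrongRainbow (hat-diameter≤2 G) colouring colour-inducedP₃
  where open HatColouring G ℓ sameLabel⇒adj
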